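{- Let $\mathbf{a}=(a_0,a_1,a_2,\ldots)$ be the increasing sequence of all $n\in\mathbb{N}$ such that $\binom{2n}{n}\equiv 1\pmod 3$. Let $\mathbf{t}=(t_0,t_1,\ldots)=(0,1,1,0,1,0,0,1,\ldots)$ be the Thue–Morse sequence, i.e. $t_i$ is the remainder on division by $2$ of the number of ones in the binary expansion of $i$. Then $a_i\equiv t_i\pmod 3$ for all $i\in\mathbb{N}$.
   Context: Equivalently, the Thue–Morse sequence is defined by $t_0=0$, $t_{2i}=t_i$, $t_{2i+1}=1-t_i$. -}

module Defs where

open import Data.Nat using (ℕ; zero; suc; _+_; _*_; _%_; _<_; ⌊_/2⌋)
open import Data.Nat.Combinatorics using (_C_)
open import Data.Product using (∃-syntax; _×_)
open import Relation.Binary.PropositionalEquality using (_≡_)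

-- number of ones in the binary expansion of n, computed with fuel k
-- (fuel k ≥ n suffices, since ⌊ n /2⌋ < n for n > 0)
onesFuel : ℕ → ℕ → ℕ
onesFuel zero    n = 0
onesFuel (suc k) n = n % 2 + onesFuel k ⌊ n /2⌋

ones : ℕ → ℕ
ones n = onesFuel n n

thueMorse : ℕ → ℕ
thueMorse i = ones i % 2

InS : ℕ → Set
InS n = ((2 * n) C n) % 3 ≡ 1

IsIncreasingEnumerationOfS : (ℕ → ℕ) → Set
IsIncreasingEnumerationOfS a =
  (∀ i → a i < a (suc i)) × ((∀ i → InS (a i)) × (∀ n → InS n → ∃[ i ] a i ≡ n))

-- By Lucas' theorem, C(2n,n) mod 3 is the product of C(2d,d) over the ternary digits d of n:
-- it vanishes as soon as a digit 2 occurs, and is 2^(number of ones) otherwise. Hence S is the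
-- image under B = binaryAsTernary (read the binary digits in base 3) of the evil numbers (those m with t_m = 0).
-- These are enumerated increasingly by i ↦ 2i + t_i and B is increasing, so
-- a_i = B(2i + t_i) = 3·B(i) + t_i ≡ t_i (mod 3).
module Submission where

open import Data.Empty using (⊥-elim)
open import Level using (0ℓ)
open import Data.Nat
open import Data.Nat.Combinatorics using (_C_; nCk≡n!/k![n-k]!; k![n∸k]!∣n!; nCk+nC[k+1]≡[n+1]C[k+1]; nCn≡1; k>n⇒nCk≡0)
open import Data.Nat.Divisibility using (_∣_; n∣m⇒m%n≡0; m∣m*n; ∣n⇒∣m*n; ∣⇒≤; ∣1⇒≡1)
open import Data.Nat.DivMod using (m≡m%n+[m/n]*n; m%n<n; m/n<m; [m+kn]%n≡m%n; m<n⇒m%n≡m; %-distribˡ-+; %-distribˡ-*; m/n*n≡m)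
open import Data.Nat.Induction using (<-rec)
open import Data.Nat.Primality using (Prime; prime?; prime⇒nonTrivial; euclidsLemma)
open import Data.Nat.Properties
open import Data.Nat.Tactic.RingSolver using (solve-∀)
open import Data.Product using (∃-syntax; _,_)
open import Data.Sum using (inj₁; inj₂)
open import Relation.Binary.Bundles using (Setoid)
open import Relation.Binary.PropositionalEquality
open import Relation.Nullary using (¬_; contradiction)
open import Relation.Nullary.Decidable using (toWitness)
open import Defs

-- A record rather than a synonym for a % n ≡ b % n: both _%_ and _C_ compute, and
-- unification could not recover a and b from the unfolded residues.
infix 4 _≡_mod_
record _≡_mod_ (a b n : ℕ) .{{_ : NonZero n}} : Set where
  constructor mk-mod
  field %≡% : a % n ≡ b % n
open _≡_mod_

module _ {n} .{{_ : NonZero n}} where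

  ≡⇒≡-mod : ∀ {a b} → a ≡ b → a ≡ b mod n
  ≡⇒≡-mod a≡b = mk-mod (cong (_% n) a≡b)

  trans-mod : ∀ {a b c} → a ≡ b mod n → b ≡ c mod n → a ≡ c mod n
  trans-mod (mk-mod a≡b) (mk-mod b≡c) = mk-mod (trans a≡b b≡c)

  +-cong-mod : ∀ {a a′ b b′} → a ≡ a′ mod n → b ≡ b′ mod n → a + b ≡ a′ + b′ mod n
  +-cong-mod {a} {a′} {b} {b′} (mk-mod a≡a′) (mk-mod b≡b′) = mk-mod (begin
    (a + b) % n                 ≡⟨ %-distribˡ-+ a b n ⟩
    (a % n + b % n) % n         ≡⟨ cong₂ (λ u v → (u + v) % n) a≡a′ b≡b′ ⟩
    (a′ % n + b′ % n) % n       ≡⟨ %-distribˡ-+ a′ b′ n ⟨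
    (a′ + b′) % n               ∎)
    where open ≡-Reasoning

  *-congʳ-mod : ∀ c {a a′} → a ≡ a′ mod n → a * c ≡ a′ * c mod n
  *-congʳ-mod c {a} {a′} (mk-mod a≡a′) = mk-mod (begin
    (a * c) % n                 ≡⟨ %-distribˡ-* a c n ⟩
    (a % n * (c % n)) % n       ≡⟨ cong (λ u → (u * (c % n)) % n) a≡a′ ⟩
    (a′ % n * (c % n)) % n      ≡⟨ %-distribˡ-* a′ c n ⟨
    (a′ * c) % n                ∎)
    where open ≡-Reasoning

  ∣⇒≡0-mod : ∀ {a} → n ∣ a → a ≡ 0 mod n
  ∣⇒≡0-mod {a} n∣a = mk-mod (trans (n∣m⇒m%n≡0 a n n∣a) (sym (m<n⇒m%n≡m (>-nonZero⁻¹ n))))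

≡-mod-setoid : (n : ℕ) .{{_ : NonZero n}} → Setoid 0ℓ 0ℓ
≡-mod-setoid n = record
  { Carrier       = ℕ
  ; _≈_           = _≡_mod n
  ; isEquivalence = record
    { refl  = mk-mod refl
    ; sym   = λ (mk-mod a≡b) → mk-mod (sym a≡b)
    ; trans = trans-mod
    }
  }

pascal : ∀ n k → suc n C suc k ≡ n C k + n C suc k
pascal n k = sym (nCk+nC[k+1]≡[n+1]C[k+1] n k)

scaled-pascal : ∀ c n k → c * (n C k) + c * (n C suc k) ≡ c * (suc n C suc k)
scaled-pascal c n k = trans (sym (*-distribˡ-+ c (n C k) (n C suc k))) (cong (c *_) (sym (pascal n k)))

binomial*factorials : ∀ {n k} → k ≤ n → (n C k) * (k ! * (n ∸ k) !) ≡ n !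
binomial*factorials {n} {k} k≤n = begin
  (n C k) * (k ! * (n ∸ k) !)             ≡⟨ cong (_* (k ! * (n ∸ k) !)) (nCk≡n!/k![n-k]! k≤n) ⟩
  n ! / (k ! * (n ∸ k) !) * (k ! * (n ∸ k) !) ≡⟨ m/n*n≡m (k![n∸k]!∣n! k≤n) ⟩
  n !                                     ∎
  where
  open ≡-Reasoning
  instance _ = k !* (n ∸ k) !≢0

prime∤! : ∀ {p k} → Prime p → k < p → ¬ p ∣ k !
prime∤! {k = zero}  pr _ p∣1 = nonTrivial⇒≢1 {{prime⇒nonTrivial pr}} (∣1⇒≡1 p∣1)
prime∤! {k = suc k} pr k<p p∣k! with euclidsLemma (suc k) (k !) pr p∣k!
... | inj₁ p∣1+k = <⇒≱ k<p (∣⇒≤ p∣1+k)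
... | inj₂ p∣k!  = prime∤! pr (<-trans (n<1+n k) k<p) p∣k!

prime∣pCk : ∀ {p k} → Prime p → 0 < k → k < p → p ∣ p C k
prime∣pCk {suc q} {k} pr 0<k k<p
  with euclidsLemma (suc q C k) (k ! * (suc q ∸ k) !) pr
         (subst (suc q ∣_) (sym (binomial*factorials (<⇒≤ k<p))) (m∣m*n (q !)))
... | inj₁ p∣C = p∣C
... | inj₂ p∣k![p-k]! with euclidsLemma (k !) ((suc q ∸ k) !) pr p∣k![p-k]!
...   | inj₁ p∣k!     = contradiction p∣k! (prime∤! pr k<p)
...   | inj₂ p∣[p-k]! = contradiction p∣[p-k]! (prime∤! pr (∸-monoʳ-< 0<k (<⇒≤ k<p)))

centralBinomial : ℕ → ℕ
centralBinomial n = (2 * n) C n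

double-digit : ∀ r h p → 2 * (r + h * p) ≡ 2 * r + 2 * h * p
double-digit = solve-∀

carry-double : ∀ {r s} h p → 2 * r ≡ s + p → 2 * (r + h * p) ≡ s + (1 + 2 * h) * p
carry-double {r} {s} h p 2r≡s+p = begin
  2 * (r + h * p)      ≡⟨ double-digit r h p ⟩
  2 * r + 2 * h * p    ≡⟨ cong (_+ 2 * h * p) 2r≡s+p ⟩
  s + p + 2 * h * p    ≡⟨ rearrange s h p ⟩
  s + (1 + 2 * h) * p  ∎
  where
  open ≡-Reasoning
  rearrange : ∀ s h p → s + p + 2 * h * p ≡ s + (1 + 2 * h) * p
  rearrange = solve-∀

carry-< : ∀ {r s p} → r < p → 2 * r ≡ s + p → s < r
carry-< {r} {s} {p} r<p 2r≡s+p = +-cancelʳ-< p s r (begin-strict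
  s + p        ≡⟨ 2r≡s+p ⟨
  r + (r + 0)  ≡⟨ cong (r +_) (+-identityʳ r) ⟩
  r + r        <⟨ +-monoʳ-< r r<p ⟩
  r + p        ∎)
  where open ≤-Reasoning

module _ {q} (prime : Prime (suc q)) where

  private
    p : ℕ
    p = suc q

  open import Relation.Binary.Reasoning.Setoid (≡-mod-setoid p)

  pascal-mod : ∀ n k {u v} → n C k ≡ u mod p → n C suc k ≡ v mod p → suc n C suc k ≡ u + v mod p
  pascal-mod n k n[k]≡u n[1+k]≡v = trans-mod (≡⇒≡-mod (pascal n k)) (+-cong-mod n[k]≡u n[1+k]≡v)

  -- Induction on (x, b), peeling one unit off b + x p with Pascal's rule. A borrow from the
  -- digit x (the case b = 0, d > 0) is where primality enters, through p ∣ p C d.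
  lucas-digit : ∀ x y b d → b < p → d < p →
                (b + x * p) C (d + y * p) ≡ (x C y) * (b C d) mod p
  lucas-digit zero    zero    zero    zero    _   _   = ≡⇒≡-mod refl
  lucas-digit zero    (suc y) zero    zero    _   _   = ≡⇒≡-mod refl
  lucas-digit zero    y       zero    (suc d) _   _   = ≡⇒≡-mod (sym (*-zeroʳ (zero C y)))
  lucas-digit (suc x) zero    zero    zero    _   _   = ≡⇒≡-mod refl
  lucas-digit (suc x) (suc y) zero    zero    _   _   = begin
    suc (q + x * p) C suc (q + y * p)
      ≈⟨ pascal-mod (q + x * p) (q + y * p) (lucas-digit x y q q ≤-refl ≤-refl)
                                            (lucas-digit x (suc y) q 0 ≤-refl z<s) ⟩
    (x C y) * (q C q) + (x C suc y) * 1
      ≡⟨ cong₂ _+_ (trans (cong ((x C y) *_) (nCn≡1 q)) (*-identityʳ (x C y))) (*-identityʳ (x C suc y)) ⟩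
    x C y + x C suc y
      ≡⟨ pascal x y ⟨
    suc x C suc y
      ≡⟨ *-identityʳ (suc x C suc y) ⟨
    (suc x C suc y) * 1
      ∎
  lucas-digit (suc x) y       zero    (suc d) _   d<p = begin
    suc (q + x * p) C suc (d + y * p)
      ≈⟨ pascal-mod (q + x * p) (d + y * p) (lucas-digit x y q d ≤-refl (<⇒≤ d<p))
                                            (lucas-digit x y q (suc d) ≤-refl d<p) ⟩
    (x C y) * (q C d) + (x C y) * (q C suc d)
      ≡⟨ scaled-pascal (x C y) q d ⟩
    (x C y) * (p C suc d)
      ≈⟨ ∣⇒≡0-mod (∣n⇒∣m*n (x C y) (prime∣pCk prime z<s d<p)) ⟩
    0
      ≡⟨ *-zeroʳ (suc x C y) ⟨
    (suc x C y) * 0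
      ∎
  lucas-digit x       zero    (suc b) zero    _   _   = ≡⇒≡-mod refl
  lucas-digit x       (suc y) (suc b) zero    b<p _   = begin
    suc (b + x * p) C suc (q + y * p)
      ≈⟨ pascal-mod (b + x * p) (q + y * p) (lucas-digit x y b q (<⇒≤ b<p) ≤-refl)
                                            (lucas-digit x (suc y) b 0 (<⇒≤ b<p) z<s) ⟩
    (x C y) * (b C q) + (x C suc y) * 1
      ≡⟨ cong (λ c → (x C y) * c + (x C suc y) * 1) (k>n⇒nCk≡0 (≤-pred b<p)) ⟩
    (x C y) * 0 + (x C suc y) * 1
      ≡⟨ cong (_+ (x C suc y) * 1) (*-zeroʳ (x C y)) ⟩
    (x C suc y) * 1
      ∎
  lucas-digit x       y       (suc b) (suc d) b<p d<p = begin
    suc (b + x * p) C suc (d + y * p)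
      ≈⟨ pascal-mod (b + x * p) (d + y * p) (lucas-digit x y b d (<⇒≤ b<p) (<⇒≤ d<p))
                                            (lucas-digit x y b (suc d) (<⇒≤ b<p) d<p) ⟩
    (x C y) * (b C d) + (x C y) * (b C suc d)
      ≡⟨ scaled-pascal (x C y) b d ⟩
    (x C y) * (suc b C suc d)
      ∎

  centralBinomial-digit : ∀ r h → 2 * r < p →
                          centralBinomial (r + h * p) ≡ centralBinomial h * centralBinomial r mod p
  centralBinomial-digit r h 2r<p =
    trans-mod (≡⇒≡-mod (cong (_C (r + h * p)) (double-digit r h p)))
              (lucas-digit (2 * h) h (2 * r) r 2r<p (≤-<-trans (m≤m+n r (r + 0)) 2r<p))

  centralBinomial-carry : ∀ r s h → r < p → 2 * r ≡ s + p → centralBinomial (r + h * p) ≡ 0 mod p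
  centralBinomial-carry r s h r<p 2r≡s+p = begin
    (2 * (r + h * p)) C (r + h * p)   ≡⟨ cong (_C (r + h * p)) (carry-double {r} h p 2r≡s+p) ⟩
    (s + (1 + 2 * h) * p) C (r + h * p) ≈⟨ lucas-digit (1 + 2 * h) h s r (<-trans s<r r<p) r<p ⟩
    ((1 + 2 * h) C h) * (s C r)       ≡⟨ cong (((1 + 2 * h) C h) *_) (k>n⇒nCk≡0 s<r) ⟩
    ((1 + 2 * h) C h) * 0             ≡⟨ *-zeroʳ ((1 + 2 * h) C h) ⟩
    0                                 ∎
    where
    s<r : s < r
    s<r = carry-< r<p 2r≡s+p

digit-induction : ∀ b .{{_ : NonTrivial b}} (P : ℕ → Set) → P 0 →
                  (∀ r h → r < b → P h → P (r + h * b)) → ∀ n → P n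
digit-induction b P P0 step = <-rec P go
  where
  instance _ = nonTrivial⇒nonZero b
  go : ∀ n → (∀ {m} → m < n → P m) → P n
  go zero      _   = P0
  go n@(suc _) rec = subst P (sym (m≡m%n+[m/n]*n n b))
    (step (n % b) (n / b) (m%n<n n b) (rec (m/n<m n b (nonTrivial⇒n>1 b))))

⌊r+h*2/2⌋≡h : ∀ {r} h → r < 2 → ⌊ r + h * 2 /2⌋ ≡ h
⌊r+h*2/2⌋≡h {0} zero    _ = refl
⌊r+h*2/2⌋≡h {0} (suc h) _ = cong suc (⌊r+h*2/2⌋≡h h z<s)
⌊r+h*2/2⌋≡h {1} zero    _ = refl
⌊r+h*2/2⌋≡h {1} (suc h) _ = cong suc (⌊r+h*2/2⌋≡h h (s<s z<s))
⌊r+h*2/2⌋≡h {suc (suc _)} _ (s≤s (s≤s ()))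

[r+h*2]%2≡r : ∀ {r} h → r < 2 → (r + h * 2) % 2 ≡ r
[r+h*2]%2≡r {r} h r<2 = trans ([m+kn]%n≡m%n r h 2) (m<n⇒m%n≡m r<2)

binaryFoldFuel : (ℕ → ℕ → ℕ) → ℕ → ℕ → ℕ
binaryFoldFuel f zero    n = 0
binaryFoldFuel f (suc k) n = f (n % 2) (binaryFoldFuel f k ⌊ n /2⌋)

binaryFold : (ℕ → ℕ → ℕ) → ℕ → ℕ
binaryFold f n = binaryFoldFuel f n n

module _ {f : ℕ → ℕ → ℕ} (f00≡0 : f 0 0 ≡ 0) where

  binaryFoldFuel-at-0 : ∀ k → binaryFoldFuel f k 0 ≡ 0
  binaryFoldFuel-at-0 zero    = refl
  binaryFoldFuel-at-0 (suc k) = trans (cong (f 0) (binaryFoldFuel-at-0 k)) f00≡0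

  binaryFoldFuel-irrelevant : ∀ {k k′ n} → n ≤ k → n ≤ k′ → binaryFoldFuel f k n ≡ binaryFoldFuel f k′ n
  binaryFoldFuel-irrelevant {zero}  {k′}     z≤n _   = sym (binaryFoldFuel-at-0 k′)
  binaryFoldFuel-irrelevant {suc k} {zero}   _   z≤n = binaryFoldFuel-at-0 (suc k)
  binaryFoldFuel-irrelevant {suc k} {suc k′} {n} n≤1+k n≤1+k′ =
    cong (f (n % 2)) (binaryFoldFuel-irrelevant (⌊n/2⌋≤ n≤1+k) (⌊n/2⌋≤ n≤1+k′))
    where
    ⌊n/2⌋≤ : ∀ {m} → n ≤ suc m → ⌊ n /2⌋ ≤ m
    ⌊n/2⌋≤ {m} n≤1+m = ≤-pred (≤-<-trans (⌊n/2⌋-mono n≤1+m) (⌊n/2⌋<n m))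

  binaryFold-unfold : ∀ n → binaryFold f n ≡ f (n % 2) (binaryFold f ⌊ n /2⌋)
  binaryFold-unfold zero    = sym f00≡0
  binaryFold-unfold (suc m) = cong (f (suc m % 2)) (binaryFoldFuel-irrelevant (≤-pred (⌊n/2⌋<n m)) ≤-refl)

  binaryFold-digit : ∀ {r} h → r < 2 → binaryFold f (r + h * 2) ≡ f r (binaryFold f h)
  binaryFold-digit {r} h r<2 = trans (binaryFold-unfold (r + h * 2))
    (cong₂ f ([r+h*2]%2≡r h r<2) (cong (binaryFold f) (⌊r+h*2/2⌋≡h h r<2)))

onesFuel≡binaryFoldFuel : ∀ k n → onesFuel k n ≡ binaryFoldFuel _+_ k n
onesFuel≡binaryFoldFuel zero    n = refl
onesFuel≡binaryFoldFuel (suc k) n = cong (n % 2 +_) (onesFuel≡binaryFoldFuel k ⌊ n /2⌋)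

ones-digit : ∀ {r} h → r < 2 → ones (r + h * 2) ≡ r + ones h
ones-digit {r} h r<2 = begin
  ones (r + h * 2)             ≡⟨ onesFuel≡binaryFoldFuel (r + h * 2) (r + h * 2) ⟩
  binaryFold _+_ (r + h * 2)   ≡⟨ binaryFold-digit refl h r<2 ⟩
  r + binaryFold _+_ h         ≡⟨ cong (r +_) (onesFuel≡binaryFoldFuel h h) ⟨
  r + ones h                   ∎
  where open ≡-Reasoning

thueMorse-digit : ∀ {r} h → r < 2 → thueMorse (r + h * 2) ≡ (r + thueMorse h) % 2
thueMorse-digit {r} h r<2 = begin
  ones (r + h * 2) % 2         ≡⟨ cong (_% 2) (ones-digit h r<2) ⟩
  (r + ones h) % 2             ≡⟨ %-distribˡ-+ r (ones h) 2 ⟩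
  (r % 2 + ones h % 2) % 2     ≡⟨ cong (λ u → (u + ones h % 2) % 2) (m<n⇒m%n≡m r<2) ⟩
  (r + thueMorse h) % 2        ∎
  where open ≡-Reasoning

binaryAsTernary : ℕ → ℕ
binaryAsTernary = binaryFold (λ r v → r + v * 3)

binaryAsTernary-digit : ∀ {r} h → r < 2 → binaryAsTernary (r + h * 2) ≡ r + binaryAsTernary h * 3
binaryAsTernary-digit = binaryFold-digit refl

thueMorse<2 : ∀ i → thueMorse i < 2
thueMorse<2 i = m%n<n (ones i) 2

StrictlyIncreasing : (ℕ → ℕ) → Set
StrictlyIncreasing g = ∀ i → g i < g (suc i)

binaryAsTernary-increasing : StrictlyIncreasing binaryAsTernary
binaryAsTernary-increasing = digit-induction 2 (λ n → binaryAsTernary n < binaryAsTernary (suc n)) z<s step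
  where
  open ≤-Reasoning
  step : ∀ r h → r < 2 → binaryAsTernary h < binaryAsTernary (suc h) →
         binaryAsTernary (r + h * 2) < binaryAsTernary (suc (r + h * 2))
  step 0 h _ _ = begin-strict
    binaryAsTernary (0 + h * 2)    ≡⟨ binaryAsTernary-digit h z<s ⟩
    binaryAsTernary h * 3          <⟨ n<1+n (binaryAsTernary h * 3) ⟩
    1 + binaryAsTernary h * 3      ≡⟨ binaryAsTernary-digit h (s<s z<s) ⟨
    binaryAsTernary (1 + h * 2)    ∎
  step 1 h _ ih = begin-strict
    binaryAsTernary (1 + h * 2)    ≡⟨ binaryAsTernary-digit h (s<s z<s) ⟩
    1 + binaryAsTernary h * 3      <⟨ n≤1+n (2 + binaryAsTernary h * 3) ⟩
    suc (binaryAsTernary h) * 3    ≤⟨ *-monoˡ-≤ 3 ih ⟩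
    binaryAsTernary (suc h) * 3    ≡⟨ binaryAsTernary-digit (suc h) z<s ⟨
    binaryAsTernary (0 + suc h * 2) ∎
  step (suc (suc _)) _ (s≤s (s≤s ())) _

-- i ↦ the i-th evil number, i.e. the i-th m with an even number of binary ones.
evil : ℕ → ℕ
evil i = thueMorse i + i * 2

evil-increasing : StrictlyIncreasing evil
evil-increasing i = begin-strict
  thueMorse i + i * 2              <⟨ +-monoˡ-< (i * 2) (thueMorse<2 i) ⟩
  2 + i * 2                        ≤⟨ m≤n+m (2 + i * 2) (thueMorse (suc i)) ⟩
  thueMorse (suc i) + suc i * 2    ∎
  where open ≤-Reasoning

[n+n]%2≡0 : ∀ n → (n + n) % 2 ≡ 0
[n+n]%2≡0 n = trans (cong (_% 2) (trans (cong (n +_) (sym (+-identityʳ n))) (*-comm 2 n)))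
                    ([m+kn]%n≡m%n 0 n 2)

thueMorse-evil : ∀ i → thueMorse (evil i) ≡ 0
thueMorse-evil i = trans (thueMorse-digit i (thueMorse<2 i)) ([n+n]%2≡0 (thueMorse i))

[r+t]%2≡0⇒r≡t : ∀ {r t} → r < 2 → t < 2 → (r + t) % 2 ≡ 0 → r ≡ t
[r+t]%2≡0⇒r≡t {0} {0} _ _ _  = refl
[r+t]%2≡0⇒r≡t {1} {1} _ _ _  = refl
[r+t]%2≡0⇒r≡t {0} {1} _ _ ()
[r+t]%2≡0⇒r≡t {1} {0} _ _ ()
[r+t]%2≡0⇒r≡t {suc (suc _)} (s≤s (s≤s ())) _ _
[r+t]%2≡0⇒r≡t {t = suc (suc _)} _ (s≤s (s≤s ())) _

evil-/2 : ∀ m → thueMorse m ≡ 0 → evil (m / 2) ≡ m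
evil-/2 m tm≡0 = begin
  thueMorse h + h * 2  ≡⟨ cong (_+ h * 2) r≡th ⟨
  r + h * 2            ≡⟨ m≡m%n+[m/n]*n m 2 ⟨
  m                    ∎
  where
  open ≡-Reasoning
  r h : ℕ
  r = m % 2
  h = m / 2
  r≡th : r ≡ thueMorse h
  r≡th = [r+t]%2≡0⇒r≡t (m%n<n m 2) (thueMorse<2 h)
    (trans (sym (thueMorse-digit h (m%n<n m 2)))
           (trans (cong thueMorse (sym (m≡m%n+[m/n]*n m 2))) tm≡0))

prime[3] : Prime 3
prime[3] = toWitness {a? = prime? 3} _

2*r<3 : ∀ {r} → r < 2 → 2 * r < 3
2*r<3 r<2 = s≤s (*-monoʳ-≤ 2 (≤-pred r<2))

parity-table : ∀ {r t} → r < 2 → t < 2 → suc t * centralBinomial r ≡ suc ((r + t) % 2) mod 3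
parity-table {0} {0} _ _ = mk-mod refl
parity-table {0} {1} _ _ = mk-mod refl
parity-table {1} {0} _ _ = mk-mod refl
parity-table {1} {1} _ _ = mk-mod refl
parity-table {suc (suc _)} (s≤s (s≤s ())) _
parity-table {t = suc (suc _)} _ (s≤s (s≤s ()))

centralBinomial-binaryAsTernary : ∀ m → centralBinomial (binaryAsTernary m) ≡ suc (thueMorse m) mod 3
centralBinomial-binaryAsTernary = digit-induction 2 _ (mk-mod refl) step
  where
  open import Relation.Binary.Reasoning.Setoid (≡-mod-setoid 3)
  step : ∀ r h → r < 2 → centralBinomial (binaryAsTernary h) ≡ suc (thueMorse h) mod 3 →
         centralBinomial (binaryAsTernary (r + h * 2)) ≡ suc (thueMorse (r + h * 2)) mod 3
  step r h r<2 ih = begin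
    centralBinomial (binaryAsTernary (r + h * 2))
      ≡⟨ cong centralBinomial (binaryAsTernary-digit h r<2) ⟩
    centralBinomial (r + binaryAsTernary h * 3)
      ≈⟨ centralBinomial-digit prime[3] r (binaryAsTernary h) (2*r<3 r<2) ⟩
    centralBinomial (binaryAsTernary h) * centralBinomial r
      ≈⟨ *-congʳ-mod (centralBinomial r) ih ⟩
    suc (thueMorse h) * centralBinomial r
      ≈⟨ parity-table r<2 (thueMorse<2 h) ⟩
    suc ((r + thueMorse h) % 2)
      ≡⟨ cong suc (thueMorse-digit h r<2) ⟨
    suc (thueMorse (r + h * 2))
      ∎

≢0-mod3⇒∈binaryAsTernary : ∀ n → ¬ (centralBinomial n ≡ 0 mod 3) → ∃[ m ] binaryAsTernary m ≡ n
≢0-mod3⇒∈binaryAsTernary = digit-induction 3 _ (λ _ → 0 , refl) step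
  where
  P : ℕ → Set
  P n = ¬ (centralBinomial n ≡ 0 mod 3) → ∃[ m ] binaryAsTernary m ≡ n
  low-digit : ∀ {r} h → r < 2 → P h → P (r + h * 3)
  low-digit {r} h r<2 ih ≢0 with ih (λ ≡0 → ≢0 (trans-mod (centralBinomial-digit prime[3] r h (2*r<3 r<2))
                                                             (*-congʳ-mod (centralBinomial r) ≡0)))
  ... | m , m↦h = r + m * 2 , trans (binaryAsTernary-digit m r<2) (cong (λ x → r + x * 3) m↦h)
  step : ∀ r h → r < 3 → P h → P (r + h * 3)
  step 0 h _ ih = low-digit h z<s ih
  step 1 h _ ih = low-digit h (s<s z<s) ih
  step 2 h _ _ ≢0 = ⊥-elim (≢0 (centralBinomial-carry prime[3] 2 1 h (s<s (s<s z<s)) refl))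
  step (suc (suc (suc _))) _ (s≤s (s≤s (s≤s ()))) _

module _ {g : ℕ → ℕ} (g-inc : StrictlyIncreasing g) where

  strictlyIncreasing-< : ∀ {i j} → i < j → g i < g j
  strictlyIncreasing-< {i} {suc j} (s≤s i≤j) with m≤n⇒m<n∨m≡n i≤j
  ... | inj₁ i<j  = <-trans (strictlyIncreasing-< i<j) (g-inc j)
  ... | inj₂ refl = g-inc i

  strictlyIncreasing-≤ : ∀ {i j} → i ≤ j → g i ≤ g j
  strictlyIncreasing-≤ i≤j with m≤n⇒m<n∨m≡n i≤j
  ... | inj₁ i<j  = <⇒≤ (strictlyIncreasing-< i<j)
  ... | inj₂ refl = ≤-refl

  strictlyIncreasing-reflects-< : ∀ {i j} → g i < g j → i < j
  strictlyIncreasing-reflects-< gi<gj = ≰⇒> (λ j≤i → <⇒≱ gi<gj (strictlyIncreasing-≤ j≤i))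

enumeration-≤ : ∀ {g h} → StrictlyIncreasing g → StrictlyIncreasing h →
                (∀ i → ∃[ j ] g j ≡ h i) → ∀ i → g i ≤ h i
enumeration-≤ {g} g-inc h-inc h⊆g zero with h⊆g zero
... | j , gj≡h0 = subst (g 0 ≤_) gj≡h0 (strictlyIncreasing-≤ g-inc z≤n)
enumeration-≤ {g} {h} g-inc h-inc h⊆g (suc i) with h⊆g (suc i)
... | j , gj≡h1+i =
  subst (g (suc i) ≤_) gj≡h1+i (strictlyIncreasing-≤ g-inc (strictlyIncreasing-reflects-< g-inc gi<gj))
  where
  gi<gj : g i < g j
  gi<gj = begin-strict
    g i        ≤⟨ enumeration-≤ g-inc h-inc h⊆g i ⟩
    h i        <⟨ h-inc i ⟩
    h (suc i)  ≡⟨ gj≡h1+i ⟨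
    g j        ∎
    where open ≤-Reasoning

enumeration-unique : ∀ {g h} → StrictlyIncreasing g → StrictlyIncreasing h →
                     (∀ i → ∃[ j ] g j ≡ h i) → (∀ i → ∃[ j ] h j ≡ g i) → ∀ i → g i ≡ h i
enumeration-unique g-inc h-inc h⊆g g⊆h i =
  ≤-antisym (enumeration-≤ g-inc h-inc h⊆g i) (enumeration-≤ h-inc g-inc g⊆h i)

S-enumeration : ℕ → ℕ
S-enumeration i = binaryAsTernary (evil i)

S-enumeration-increasing : StrictlyIncreasing S-enumeration
S-enumeration-increasing i =
  strictlyIncreasing-< binaryAsTernary-increasing (evil-increasing i)

S-enumeration-∈S : ∀ i → InS (S-enumeration i)
S-enumeration-∈S i = %≡% (trans-mod (centralBinomial-binaryAsTernary (evil i))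
                                    (≡⇒≡-mod (cong suc (thueMorse-evil i))))

∈S⇒S-enumeration : ∀ {n} → InS n → ∃[ i ] S-enumeration i ≡ n
∈S⇒S-enumeration {n} n∈S with ≢0-mod3⇒∈binaryAsTernary n (λ ≡0 → 1+n≢0 (trans (sym n∈S) (%≡% ≡0)))
... | m , m↦n = m / 2 , trans (cong binaryAsTernary (evil-/2 m tm≡0)) m↦n
  where
  1+tm≡1 : suc (thueMorse m) % 3 ≡ 1
  1+tm≡1 = trans (sym (%≡% (centralBinomial-binaryAsTernary m)))
                 (trans (cong (λ x → centralBinomial x % 3) m↦n) n∈S)
  tm≡0 : thueMorse m ≡ 0
  tm≡0 = suc-injective (trans (sym (m<n⇒m%n≡m (s<s (thueMorse<2 m)))) 1+tm≡1)

theorem4p5 : (a : ℕ → ℕ) → IsIncreasingEnumerationOfS a →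
    ∀ i → a i % 3 ≡ thueMorse i % 3
theorem4p5 a (a-inc , a∈S , S⊆a) i = begin
  a i % 3                                      ≡⟨ cong (_% 3) a≡S-enumeration ⟩
  binaryAsTernary (evil i) % 3                 ≡⟨ cong (_% 3) (binaryAsTernary-digit i (thueMorse<2 i)) ⟩
  (thueMorse i + binaryAsTernary i * 3) % 3    ≡⟨ [m+kn]%n≡m%n (thueMorse i) (binaryAsTernary i) 3 ⟩
  thueMorse i % 3                              ∎
  where
  open ≡-Reasoning
  a≡S-enumeration : a i ≡ S-enumeration i
  a≡S-enumeration = enumeration-unique a-inc S-enumeration-increasing
    (λ j → S⊆a (S-enumeration j) (S-enumeration-∈S j))
    (λ j → ∈S⇒S-enumeration (a∈S j)) i
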